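{- Let $\lambda$ be a nonzero real number. For integers $n\ge 0$ let $(x)_{0,\lambda}=1$ and $(x)_{n,\lambda}=x(x-\lambda)\cdots(x-(n-1)\lambda)$ for $n\ge1$. Define the degenerate Eulerian polynomials $A_{n,\lambda}(x)$ by $\sum_{j=0}^{\infty}(j+1)_{n,\lambda}x^{j}=\frac{A_{n,\lambda}(x)}{(1-x)^{n+1}}$ for $|x|<1$. Then $A_{0,\lambda}(x)=1$ and, for $n\ge1$, \[A_{n,\lambda}(x)=\sum_{i=0}^{n-1}\binom{n}{i}A_{i,\lambda}(x)\,(1)_{n-i,-\lambda}\,(x-1)^{n-i-1}.\]
   Context: $(1)_{m,-\lambda}=1(1+\lambda)(1+2\lambda)\cdots(1+(m-1)\lambda)$, i.e. the degenerate falling factorial with parameter $-\lambda$. -}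

module Defs where

open import Level using (Level)
open import Data.Nat using (ℕ; zero; suc; _∸_)
open import Data.Nat.Combinatorics using (_C_)
open import Algebra.Bundles using (CommutativeRing)

-- Formal power series over a commutative ring R, represented by their
-- coefficient sequences (coefficient of x^k at index k).  The analytic
-- definition "for |x| < 1" is replaced by the equivalent identity of
-- formal power series.

module _ {c ℓ : Level} (R : CommutativeRing c ℓ) where
  open CommutativeRing R

  Series : Set c
  Series = ℕ → Carrier

  _≈ₛ_ : Series → Series → Set ℓ
  f ≈ₛ g = ∀ k → f k ≈ g k

  ℕ→R : ℕ → Carrier
  ℕ→R zero    = 0#
  ℕ→R (suc n) = 1# + ℕ→R n

  sumTo : ℕ → (ℕ → Carrier) → Carrier
  sumTo zero    f = 0#
  sumTo (suc n) f = sumTo n f + f n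

  dfall : Carrier → ℕ → Carrier → Carrier
  dfall x zero    lam = 1#
  dfall x (suc n) lam = dfall x n lam * (x - ℕ→R n * lam)

  _*ₛ_ : Series → Series → Series
  (f *ₛ g) k = sumTo (suc k) (λ i → f i * g (k ∸ i))

  _·ₛ_ : Carrier → Series → Series
  (a ·ₛ f) k = a * f k

  _+ₛ_ : Series → Series → Series
  (f +ₛ g) k = f k + g k

  sumₛ : ℕ → (ℕ → Series) → Series
  sumₛ zero    F = λ _ → 0#
  sumₛ (suc n) F = sumₛ n F +ₛ F n

  oneₛ : Series
  oneₛ zero    = 1#
  oneₛ (suc k) = 0#

  _^ₛ_ : Series → ℕ → Series
  f ^ₛ zero  = oneₛ
  f ^ₛ suc n = (f ^ₛ n) *ₛ f

  oneMinusX : Series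
  oneMinusX zero          = 1#
  oneMinusX (suc zero)    = - 1#
  oneMinusX (suc (suc k)) = 0#

  xMinusOne : Series
  xMinusOne zero          = - 1#
  xMinusOne (suc zero)    = 1#
  xMinusOne (suc (suc k)) = 0#

  genSeries : Carrier → ℕ → Series
  genSeries lam n j = dfall (ℕ→R (suc j)) n lam

  -- degenerate Eulerian polynomial A_{n,λ}(x), defined by
  -- Σ_j (j+1)_{n,λ} x^j = A_{n,λ}(x) / (1-x)^{n+1},
  -- i.e. A_{n,λ} = (1-x)^{n+1} · Σ_j (j+1)_{n,λ} x^j
  eulerA : Carrier → ℕ → Series
  eulerA lam n = (oneMinusX ^ₛ suc n) *ₛ genSeries lam n

  recRHS : Carrier → ℕ → Series
  recRHS lam n = sumₛ n (λ i →
    (ℕ→R (n C i) * dfall 1# (n ∸ i) (- lam)) ·ₛ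
      (eulerA lam i *ₛ (xMinusOne ^ₛ (n ∸ i ∸ 1))))

module Submission where

-- Multiplying a series by 1 - x is the backward difference ∇ and multiplying by x - 1 is -∇,
-- so A_{n,λ} = ∇^{n+1} G_n for G_n = Σ_j (j+1)_{n,λ} x^j, and (x-1)^m A_{i,λ} = (-1)^m ∇^{m+i+1} G_i.
-- The degenerate Vandermonde identity (a+b)_{n,λ} = Σ_i C(n,i) (a)_{i,λ} (b)_{n-i,λ} at a = j+1,
-- b = -1, together with (-1)_{m,λ} = (-1)^m (1)_{m,-λ}, expresses ∇G_n as a combination of
-- G_0, …, G_{n-1}; applying ∇^n to it gives the recurrence.

open import Defs
open import Level using (Level; _⊔_)
open import Data.Nat as ℕ using (ℕ; zero; suc; _∸_; _≤_; _<_)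
import Data.Nat.Properties as ℕₚ
open import Data.Nat.Combinatorics using (_C_; nCn≡1; nCk+nC[k+1]≡[n+1]C[k+1])
open import Data.Nat.Combinatorics.Specification using (k>n⇒nCk≡0)
open import Data.Nat.GeneralisedArithmetic using (fold; fold-+)
open import Data.Product using (_×_; _,_)
open import Function using (_∘_)
open import Relation.Nullary using (¬_)
open import Algebra.Bundles using (CommutativeRing)
import Relation.Binary.PropositionalEquality as ≡

module _ {c ℓ : Level} (R : CommutativeRing c ℓ) where
  open CommutativeRing R
  open import Algebra.Properties.Semiring.Exp semiring using (_^_)
  open import Algebra.Properties.Ring ring
    using (-1*x≈-x; -‿involutive; -‿anti-homo-+; -‿distribʳ-*; xyx⁻¹≈y)
  open import Algebra.Properties.CommutativeSemigroup +-commutativeSemigroup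
    using (interchange; x∙yz≈y∙xz)
  open import Algebra.Solver.Ring.NaturalCoefficients.Default commutativeSemiring
  open import Relation.Binary.Reasoning.Setoid setoid

  -1*-1≈1 : - 1# * - 1# ≈ 1#
  -1*-1≈1 = trans (-1*x≈-x (- 1#)) (-‿involutive 1#)

  x-y≈x+-1*y : ∀ x y → x - y ≈ x + - 1# * y
  x-y≈x+-1*y x y = +-congˡ (sym (-1*x≈-x y))

  ι : ℕ → Carrier
  ι = ℕ→R R

  ι-+ : ∀ m n → ι (m ℕ.+ n) ≈ ι m + ι n
  ι-+ zero    n = sym (+-identityˡ _)
  ι-+ (suc m) n = trans (+-congˡ (ι-+ m n)) (sym (+-assoc _ _ _))

  ι-∸ : ∀ {i n} → i ≤ n → ι n ≈ ι i + ι (n ∸ i)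
  ι-∸ {i} {n} i≤n = trans (reflexive (≡.cong ι (≡.sym (ℕₚ.m+[n∸m]≡n i≤n)))) (ι-+ i (n ∸ i))

  Σ< : ℕ → (ℕ → Carrier) → Carrier
  Σ< = sumTo R

  infix 6.5 Σ<
  syntax Σ< n (λ i → e) = Σ[ i < n ] e

  Σ<-cong : ∀ n {f g : ℕ → Carrier} → (∀ i → i < n → f i ≈ g i) → Σ< n f ≈ Σ< n g
  Σ<-cong zero    f≈g = refl
  Σ<-cong (suc n) f≈g = +-cong (Σ<-cong n (λ i i<n → f≈g i (ℕₚ.m<n⇒m<1+n i<n))) (f≈g n ℕₚ.≤-refl)

  Σ<-head : ∀ n (f : ℕ → Carrier) → Σ< (suc n) f ≈ f 0 + Σ< n (f ∘ suc)
  Σ<-head zero    f = +-comm 0# (f 0)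
  Σ<-head (suc n) f = trans (+-congʳ (Σ<-head n f)) (+-assoc _ _ _)

  Σ<-zero : ∀ n {f : ℕ → Carrier} → (∀ i → f i ≈ 0#) → Σ< n f ≈ 0#
  Σ<-zero zero    f≈0 = refl
  Σ<-zero (suc n) f≈0 = trans (+-cong (Σ<-zero n f≈0) (f≈0 n)) (+-identityˡ 0#)

  Σ<-distrib-+ : ∀ n (f g : ℕ → Carrier) → Σ[ i < n ] (f i + g i) ≈ Σ< n f + Σ< n g
  Σ<-distrib-+ zero    f g = sym (+-identityˡ 0#)
  Σ<-distrib-+ (suc n) f g = trans (+-congʳ (Σ<-distrib-+ n f g)) (interchange _ _ _ _)

  *-distribˡ-Σ< : ∀ n a (f : ℕ → Carrier) → a * Σ< n f ≈ Σ[ i < n ] a * f i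
  *-distribˡ-Σ< zero    a f = zeroʳ a
  *-distribˡ-Σ< (suc n) a f = trans (distribˡ a _ _) (+-congʳ (*-distribˡ-Σ< n a f))

  *-distribʳ-Σ< : ∀ n a (f : ℕ → Carrier) → Σ< n f * a ≈ Σ[ i < n ] f i * a
  *-distribʳ-Σ< zero    a f = zeroˡ a
  *-distribʳ-Σ< (suc n) a f = trans (distribʳ a _ _) (+-congʳ (*-distribʳ-Σ< n a f))

  Σ<-reverse : ∀ n (f : ℕ → Carrier) → Σ< (suc n) f ≈ Σ[ i < suc n ] f (n ∸ i)
  Σ<-reverse zero    f = refl
  Σ<-reverse (suc n) f = begin
    Σ< (suc n) f + f (suc n)                   ≈⟨ +-congʳ (Σ<-reverse n f) ⟩
    Σ[ i < suc n ] f (n ∸ i) + f (suc n)       ≈⟨ +-comm _ _ ⟩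
    f (suc n) + Σ[ i < suc n ] f (n ∸ i)       ≈⟨ Σ<-head (suc n) (λ i → f (suc n ∸ i)) ⟨
    Σ[ i < suc (suc n) ] f (suc n ∸ i)         ∎

  binConv : ℕ → (ℕ → Carrier) → (ℕ → Carrier) → Carrier
  binConv n u v = Σ[ i < suc n ] ι (n C i) * (u i * v (n ∸ i))

  binConv-suc : ∀ n u v → binConv (suc n) u v ≈ binConv n (u ∘ suc) v + binConv n u (v ∘ suc)
  binConv-suc n u v = begin
    binConv (suc n) u v
      ≈⟨ Σ<-head (suc n) _ ⟩
    t₀ + Σ[ i < suc n ] ι (suc n C suc i) * X i
      ≈⟨ +-congˡ (Σ<-cong (suc n) (λ i _ → pascal i)) ⟩
    t₀ + Σ[ i < suc n ] (ι (n C i) * X i + ι (n C suc i) * X i)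
      ≈⟨ +-congˡ (Σ<-distrib-+ (suc n) _ _) ⟩
    t₀ + (binConv n (u ∘ suc) v + (Σ[ i < n ] ι (n C suc i) * X i + ι (n C suc n) * X n))
      ≈⟨ +-congˡ (+-congˡ (trans (+-congˡ top-vanishes) (+-identityʳ _))) ⟩
    t₀ + (binConv n (u ∘ suc) v + Σ[ i < n ] ι (n C suc i) * X i)
      ≈⟨ x∙yz≈y∙xz _ _ _ ⟩
    binConv n (u ∘ suc) v + (t₀ + Σ[ i < n ] ι (n C suc i) * X i)
      ≈⟨ +-congˡ (+-congˡ (Σ<-cong n (λ i i<n → *-congˡ (*-congˡ (reflexive
           (≡.cong v (ℕₚ.+-∸-assoc 1 i<n))))))) ⟩
    binConv n (u ∘ suc) v + (t₀ + Σ[ i < n ] ι (n C suc i) * (u (suc i) * v (suc (n ∸ suc i))))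
      ≈⟨ +-congˡ (Σ<-head n _) ⟨
    binConv n (u ∘ suc) v + binConv n u (v ∘ suc)
      ∎
    where
    t₀ : Carrier
    t₀ = ι 1 * (u 0 * v (suc n))

    X : ℕ → Carrier
    X i = u (suc i) * v (n ∸ i)

    pascal : ∀ i → ι (suc n C suc i) * X i ≈ ι (n C i) * X i + ι (n C suc i) * X i
    pascal i = begin
      ι (suc n C suc i) * X i                  ≡⟨ ≡.cong (λ m → ι m * X i) (nCk+nC[k+1]≡[n+1]C[k+1] n i) ⟨
      ι (n C i ℕ.+ n C suc i) * X i            ≈⟨ *-congʳ (ι-+ (n C i) (n C suc i)) ⟩
      (ι (n C i) + ι (n C suc i)) * X i        ≈⟨ distribʳ _ _ _ ⟩
      ι (n C i) * X i + ι (n C suc i) * X i    ∎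

    top-vanishes : ι (n C suc n) * X n ≈ 0#
    top-vanishes = trans (*-congʳ (reflexive (≡.cong ι (k>n⇒nCk≡0 (ℕₚ.n<1+n n))))) (zeroˡ _)

  dfall-cong : ∀ {x y} n l → x ≈ y → dfall R x n l ≈ dfall R y n l
  dfall-cong zero    l x≈y = refl
  dfall-cong (suc n) l x≈y = *-cong (dfall-cong n l x≈y) (+-congʳ x≈y)

  a+b-[x+y]l≈[a-xl]+[b-yl] : ∀ a b x y l → (a + b) - (x + y) * l ≈ (a - x * l) + (b - y * l)
  a+b-[x+y]l≈[a-xl]+[b-yl] a b x y l = begin
    (a + b) - (x + y) * l                         ≈⟨ x-y≈x+-1*y _ _ ⟩
    (a + b) + - 1# * ((x + y) * l)                ≈⟨ solve 6 (λ m a b x y l →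
                                                       (a :+ b) :+ m :* ((x :+ y) :* l)
                                                    := (a :+ m :* (x :* l)) :+ (b :+ m :* (y :* l))) refl (- 1#) a b x y l ⟩
    (a + - 1# * (x * l)) + (b + - 1# * (y * l))   ≈⟨ +-cong (x-y≈x+-1*y _ _) (x-y≈x+-1*y _ _) ⟨
    (a - x * l) + (b - y * l)                     ∎

  dfall-+ : ∀ a b l n → dfall R (a + b) n l ≈ binConv n (λ i → dfall R a i l) (λ j → dfall R b j l)
  dfall-+ a b l zero = sym (trans (+-identityˡ _) (trans (*-cong (+-identityʳ 1#) (*-identityˡ 1#)) (*-identityˡ 1#)))
  dfall-+ a b l (suc n) = begin
    dfall R (a + b) n l * (a + b - ι n * l)                    ≈⟨ *-congʳ (dfall-+ a b l n) ⟩
    binConv n A B * (a + b - ι n * l)                         ≈⟨ *-distribʳ-Σ< (suc n) _ _ ⟩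
    Σ[ i < suc n ] ι (n C i) * (A i * B (n ∸ i)) * (a + b - ι n * l)
      ≈⟨ Σ<-cong (suc n) (λ i i<1+n → split (ℕ.s≤s⁻¹ i<1+n)) ⟩
    Σ[ i < suc n ] (ι (n C i) * (A (suc i) * B (n ∸ i)) + ι (n C i) * (A i * B (suc (n ∸ i))))
      ≈⟨ Σ<-distrib-+ (suc n) _ _ ⟩
    binConv n (A ∘ suc) B + binConv n A (B ∘ suc)             ≈⟨ binConv-suc n A B ⟨
    binConv (suc n) A B                                       ∎
    where
    A B : ℕ → Carrier
    A i = dfall R a i l
    B j = dfall R b j l

    split : ∀ {i} → i ≤ n → ι (n C i) * (A i * B (n ∸ i)) * (a + b - ι n * l)
          ≈ ι (n C i) * (A (suc i) * B (n ∸ i)) + ι (n C i) * (A i * B (suc (n ∸ i)))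
    split {i} i≤n = begin
      ι (n C i) * (A i * B (n ∸ i)) * (a + b - ι n * l)
        ≈⟨ *-congˡ (+-congˡ (-‿cong (*-congʳ (ι-∸ i≤n)))) ⟩
      ι (n C i) * (A i * B (n ∸ i)) * (a + b - (ι i + ι (n ∸ i)) * l)
        ≈⟨ *-congˡ (a+b-[x+y]l≈[a-xl]+[b-yl] a b _ _ l) ⟩
      ι (n C i) * (A i * B (n ∸ i)) * ((a - ι i * l) + (b - ι (n ∸ i) * l))
        ≈⟨ solve 5 (λ C x y s t → C :* (x :* y) :* (s :+ t) := C :* ((x :* s) :* y) :+ C :* (x :* (y :* t)))
             refl (ι (n C i)) (A i) (B (n ∸ i)) (a - ι i * l) (b - ι (n ∸ i) * l) ⟩
      ι (n C i) * (A (suc i) * B (n ∸ i)) + ι (n C i) * (A i * B (suc (n ∸ i))) ∎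

  -x-yl≈-1*[x-y[-l]] : ∀ x y l → - x - y * l ≈ - 1# * (x - y * - l)
  -x-yl≈-1*[x-y[-l]] x y l = begin
    - x - y * l               ≈⟨ +-comm _ _ ⟩
    - (y * l) + - x           ≈⟨ +-congʳ (-‿distribʳ-* y l) ⟩
    y * - l + - x             ≈⟨ +-congʳ (-‿involutive _) ⟨
    - - (y * - l) + - x       ≈⟨ -‿anti-homo-+ x (- (y * - l)) ⟨
    - (x - y * - l)           ≈⟨ -1*x≈-x _ ⟨
    - 1# * (x - y * - l)      ∎

  dfall-neg : ∀ x m l → dfall R (- x) m l ≈ (- 1#) ^ m * dfall R x m (- l)
  dfall-neg x zero    l = sym (*-identityˡ 1#)
  dfall-neg x (suc m) l = begin
    dfall R (- x) m l * (- x - ι m * l)               ≈⟨ *-cong (dfall-neg x m l) (-x-yl≈-1*[x-y[-l]] x (ι m) l) ⟩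
    (s * d) * (- 1# * (x - ι m * - l))                ≈⟨ solve 4 (λ s d m t → (s :* d) :* (m :* t) := (m :* s) :* (d :* t))
                                                          refl s d (- 1#) (x - ι m * - l) ⟩
    (- 1# * s) * (d * (x - ι m * - l))                ∎
    where
    s d : Carrier
    s = (- 1#) ^ m
    d = dfall R x m (- l)

  -1*dfall[-1]≈dfall[1]*±1 : ∀ j l → - 1# * dfall R (- 1#) (suc j) l ≈ dfall R 1# (suc j) (- l) * (- 1#) ^ j
  -1*dfall[-1]≈dfall[1]*±1 j l = begin
    - 1# * dfall R (- 1#) (suc j) l          ≈⟨ *-congˡ (dfall-neg 1# (suc j) l) ⟩
    - 1# * ((- 1# * s) * d)                  ≈⟨ solve 3 (λ m s d → m :* ((m :* s) :* d) := (m :* m) :* (d :* s)) refl (- 1#) s d ⟩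
    (- 1# * - 1#) * (d * s)                  ≈⟨ trans (*-congʳ -1*-1≈1) (*-identityˡ _) ⟩
    d * s                                    ∎
    where
    s d : Carrier
    s = (- 1#) ^ j
    d = dfall R 1# (suc j) (- l)

  dfall-0# : ∀ n l → dfall R 0# (suc n) l ≈ 0#
  dfall-0# zero    l = trans (*-identityˡ _) (trans (+-congˡ (-‿cong (zeroˡ l))) (-‿inverseʳ 0#))
  dfall-0# (suc n) l = trans (*-congʳ (dfall-0# n l)) (zeroˡ _)

  infix  4 _≋_
  infixl 6 _⊕_
  infixr 7 _·_
  infixl 7 _⋆_
  infixr 8 _⋆^_

  _≋_ : Series R → Series R → Set ℓ
  _≋_ = _≈ₛ_ R

  _⊕_ : Series R → Series R → Series R
  _⊕_ = _+ₛ_ R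

  _·_ : Carrier → Series R → Series R
  _·_ = _·ₛ_ R

  _⋆_ : Series R → Series R → Series R
  _⋆_ = _*ₛ_ R

  _⋆^_ : Series R → ℕ → Series R
  _⋆^_ = _^ₛ_ R

  𝟘 : Series R
  𝟘 _ = 0#

  𝟙 : Series R
  𝟙 = oneₛ R

  sumₛ-apply : ∀ n F k → sumₛ R n F k ≈ Σ[ i < n ] F i k
  sumₛ-apply zero    F k = refl
  sumₛ-apply (suc n) F k = +-congʳ (sumₛ-apply n F k)

  sumₛ-cong : ∀ n {F G : ℕ → Series R} → (∀ i → i < n → F i ≋ G i) → sumₛ R n F ≋ sumₛ R n G
  sumₛ-cong n F≋G k = begin
    sumₛ R n _ k     ≈⟨ sumₛ-apply n _ k ⟩
    Σ< n _           ≈⟨ Σ<-cong n (λ i i<n → F≋G i i<n k) ⟩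
    Σ< n _           ≈⟨ sumₛ-apply n _ k ⟨
    sumₛ R n _ k     ∎

  record IsLinear (T : Series R → Series R) : Set (c ⊔ ℓ) where
    field
      cong   : ∀ {f g} → f ≋ g → T f ≋ T g
      ⊕-homo : ∀ f g → T (f ⊕ g) ≋ T f ⊕ T g
      ·-homo : ∀ a f → T (a · f) ≋ a · T f
      𝟘-homo : T 𝟘 ≋ 𝟘

  id-isLinear : IsLinear (λ f → f)
  id-isLinear = record
    { cong   = λ f≋g → f≋g
    ; ⊕-homo = λ _ _ _ → refl
    ; ·-homo = λ _ _ _ → refl
    ; 𝟘-homo = λ _ → refl
    }

  ∘-isLinear : ∀ {S T} → IsLinear S → IsLinear T → IsLinear (S ∘ T)
  ∘-isLinear S T = record
    { cong   = λ f≋g → S.cong (T.cong f≋g)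
    ; ⊕-homo = λ f g k → trans (S.cong (T.⊕-homo f g) k) (S.⊕-homo _ _ k)
    ; ·-homo = λ a f k → trans (S.cong (T.·-homo a f) k) (S.·-homo a _ k)
    ; 𝟘-homo = λ k → trans (S.cong T.𝟘-homo k) (S.𝟘-homo k)
    }
    where
    module S = IsLinear S
    module T = IsLinear T

  fold-isLinear : ∀ {T} → IsLinear T → ∀ m → IsLinear (λ f → fold f T m)
  fold-isLinear T zero    = id-isLinear
  fold-isLinear T (suc m) = ∘-isLinear T (fold-isLinear T m)

  IsLinear⇒sumₛ-homo : ∀ {T} → IsLinear T → ∀ n F → T (sumₛ R n F) ≋ sumₛ R n (T ∘ F)
  IsLinear⇒sumₛ-homo T zero    F = IsLinear.𝟘-homo T
  IsLinear⇒sumₛ-homo T (suc n) F k =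
    trans (IsLinear.⊕-homo T _ _ k) (+-congʳ (IsLinear⇒sumₛ-homo T n F k))

  shift : Series R → Series R
  shift f zero    = 0#
  shift f (suc k) = f k

  shift-isLinear : IsLinear shift
  shift-isLinear = record
    { cong   = λ { f≋g zero → refl ; f≋g (suc k) → f≋g k }
    ; ⊕-homo = λ { f g zero → sym (+-identityˡ 0#) ; f g (suc k) → refl }
    ; ·-homo = λ { a f zero → sym (zeroʳ a) ; a f (suc k) → refl }
    ; 𝟘-homo = λ { zero → refl ; (suc k) → refl }
    }

  linMul : Carrier → Carrier → Series R → Series R
  linMul a b f = a · f ⊕ b · shift f

  linMul-isLinear : ∀ a b → IsLinear (linMul a b)
  linMul-isLinear a b = record
    { cong   = λ f≋g k → +-cong (*-congˡ (f≋g k)) (*-congˡ (S.cong f≋g k))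
    ; ⊕-homo = λ f g k → trans (+-congˡ (*-congˡ (S.⊕-homo f g k)))
        (solve 6 (λ a b x y u v → a :* (x :+ y) :+ b :* (u :+ v) := (a :* x :+ b :* u) :+ (a :* y :+ b :* v))
           refl a b (f k) (g k) (shift f k) (shift g k))
    ; ·-homo = λ e f k → trans (+-congˡ (*-congˡ (S.·-homo e f k)))
        (solve 5 (λ a b e x u → a :* (e :* x) :+ b :* (e :* u) := e :* (a :* x :+ b :* u))
           refl a b e (f k) (shift f k))
    ; 𝟘-homo = λ k → trans (+-cong (zeroʳ a) (trans (*-congˡ (S.𝟘-homo k)) (zeroʳ b))) (+-identityˡ 0#)
    }
    where
    module S = IsLinear shift-isLinear

  linMul^ : Carrier → Carrier → ℕ → Series R → Series R
  linMul^ a b m f = fold f (linMul a b) m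

  linMul^-isLinear : ∀ a b m → IsLinear (linMul^ a b m)
  linMul^-isLinear a b = fold-isLinear (linMul-isLinear a b)

  ∇ : Series R → Series R
  ∇ = linMul 1# (- 1#)

  ∇^ : ℕ → Series R → Series R
  ∇^ = linMul^ 1# (- 1#)

  linMul[-1,1]≋-∇ : ∀ f → linMul (- 1#) 1# f ≋ - 1# · ∇ f
  linMul[-1,1]≋-∇ f k = sym (begin
    - 1# * (1# * f k + - 1# * shift f k)        ≈⟨ solve 3 (λ m x y → m :* (con 1 :* x :+ m :* y) := m :* x :+ (m :* m) :* y)
                                                     refl (- 1#) (f k) (shift f k) ⟩
    - 1# * f k + (- 1# * - 1#) * shift f k      ≈⟨ +-congˡ (*-congʳ -1*-1≈1) ⟩
    - 1# * f k + 1# * shift f k                 ∎)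

  linMul^[-1,1]≋±∇^ : ∀ m f → linMul^ (- 1#) 1# m f ≋ (- 1#) ^ m · ∇^ m f
  linMul^[-1,1]≋±∇^ zero    f k = sym (*-identityˡ _)
  linMul^[-1,1]≋±∇^ (suc m) f k = begin
    linMul (- 1#) 1# (linMul^ (- 1#) 1# m f) k     ≈⟨ IsLinear.cong (linMul-isLinear (- 1#) 1#) (linMul^[-1,1]≋±∇^ m f) k ⟩
    linMul (- 1#) 1# ((- 1#) ^ m · ∇^ m f) k       ≈⟨ linMul[-1,1]≋-∇ _ k ⟩
    - 1# * ∇ ((- 1#) ^ m · ∇^ m f) k               ≈⟨ *-congˡ (IsLinear.·-homo (linMul-isLinear 1# (- 1#)) _ _ k) ⟩
    - 1# * ((- 1#) ^ m * ∇^ (suc m) f k)           ≈⟨ *-assoc _ _ _ ⟨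
    (- 1#) ^ suc m * ∇^ (suc m) f k                ∎

  ⋆-congˡ : ∀ {f f′} g → f ≋ f′ → f ⋆ g ≋ f′ ⋆ g
  ⋆-congˡ g f≋f′ k = Σ<-cong (suc k) (λ i _ → *-congʳ (f≋f′ i))

  ⋆-comm : ∀ f g → f ⋆ g ≋ g ⋆ f
  ⋆-comm f g k = begin
    Σ[ i < suc k ] f i * g (k ∸ i)                   ≈⟨ Σ<-reverse k _ ⟩
    Σ[ i < suc k ] f (k ∸ i) * g (k ∸ (k ∸ i))       ≈⟨ Σ<-cong (suc k) (λ i i<1+k →
                                                          trans (*-comm _ _) (*-congʳ (reflexive
                                                            (≡.cong g (ℕₚ.m∸[m∸n]≡n (ℕ.s≤s⁻¹ i<1+k)))))) ⟩
    Σ[ i < suc k ] g i * f (k ∸ i)                   ∎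

  ⋆-isLinearˡ : ∀ g → IsLinear (_⋆ g)
  ⋆-isLinearˡ g = record
    { cong   = ⋆-congˡ g
    ; ⊕-homo = λ f h k → trans (Σ<-cong (suc k) (λ i _ → distribʳ _ _ _)) (Σ<-distrib-+ (suc k) _ _)
    ; ·-homo = λ a f k → trans (Σ<-cong (suc k) (λ i _ → *-assoc _ _ _)) (sym (*-distribˡ-Σ< (suc k) a _))
    ; 𝟘-homo = λ k → Σ<-zero (suc k) (λ i → zeroˡ _)
    }

  shift-⋆ : ∀ f g → shift f ⋆ g ≋ shift (f ⋆ g)
  shift-⋆ f g zero    = trans (+-identityˡ _) (zeroˡ _)
  shift-⋆ f g (suc k) = trans (Σ<-head (suc k) _) (trans (+-congʳ (zeroˡ _)) (+-identityˡ _))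

  linMul-⋆ : ∀ a b f g → linMul a b f ⋆ g ≋ linMul a b (f ⋆ g)
  linMul-⋆ a b f g k = begin
    ((a · f ⊕ b · shift f) ⋆ g) k                ≈⟨ ⋆g.⊕-homo _ _ k ⟩
    ((a · f) ⋆ g) k + ((b · shift f) ⋆ g) k      ≈⟨ +-cong (⋆g.·-homo a f k) (⋆g.·-homo b (shift f) k) ⟩
    a * (f ⋆ g) k + b * (shift f ⋆ g) k          ≈⟨ +-congˡ (*-congˡ (shift-⋆ f g k)) ⟩
    a * (f ⋆ g) k + b * shift (f ⋆ g) k          ∎
    where module ⋆g = IsLinear (⋆-isLinearˡ g)

  𝟙-⋆ : ∀ g → 𝟙 ⋆ g ≋ g
  𝟙-⋆ g k = begin
    (𝟙 ⋆ g) k                                     ≈⟨ Σ<-head k _ ⟩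
    1# * g k + Σ[ i < k ] 0# * g (k ∸ suc i)      ≈⟨ +-cong (*-identityˡ _) (Σ<-zero k (λ i → zeroˡ _)) ⟩
    g k + 0#                                      ≈⟨ +-identityʳ _ ⟩
    g k                                           ∎

  Degree≤1 : Series R → Set ℓ
  Degree≤1 p = ∀ j → p (suc (suc j)) ≈ 0#

  Degree≤1⇒≋linMul-𝟙 : ∀ {p} → Degree≤1 p → p ≋ linMul (p 0) (p 1) 𝟙
  Degree≤1⇒≋linMul-𝟙 {p} p₂₊≈0 zero          = sym (trans (+-cong (*-identityʳ _) (zeroʳ _)) (+-identityʳ _))
  Degree≤1⇒≋linMul-𝟙 {p} p₂₊≈0 (suc zero)    = sym (trans (+-cong (zeroʳ _) (*-identityʳ _)) (+-identityˡ _))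
  Degree≤1⇒≋linMul-𝟙 {p} p₂₊≈0 (suc (suc j)) =
    trans (p₂₊≈0 j) (sym (trans (+-cong (zeroʳ _) (zeroʳ _)) (+-identityˡ 0#)))

  Degree≤1⇒⋆≋linMul : ∀ {p} → Degree≤1 p → ∀ g → p ⋆ g ≋ linMul (p 0) (p 1) g
  Degree≤1⇒⋆≋linMul {p} p₂₊≈0 g k = begin
    (p ⋆ g) k                           ≈⟨ ⋆-congˡ g (Degree≤1⇒≋linMul-𝟙 p₂₊≈0) k ⟩
    (linMul (p 0) (p 1) 𝟙 ⋆ g) k        ≈⟨ linMul-⋆ (p 0) (p 1) 𝟙 g k ⟩
    linMul (p 0) (p 1) (𝟙 ⋆ g) k        ≈⟨ IsLinear.cong (linMul-isLinear (p 0) (p 1)) (𝟙-⋆ g) k ⟩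
    linMul (p 0) (p 1) g k              ∎

  Degree≤1⇒⋆^≋linMul^ : ∀ {p} → Degree≤1 p → ∀ m g → p ⋆^ m ⋆ g ≋ linMul^ (p 0) (p 1) m g
  Degree≤1⇒⋆^≋linMul^ {p} p₂₊≈0 zero    g = 𝟙-⋆ g
  Degree≤1⇒⋆^≋linMul^ {p} p₂₊≈0 (suc m) g k = begin
    ((p ⋆^ m ⋆ p) ⋆ g) k                      ≈⟨ ⋆-congˡ g (⋆-comm (p ⋆^ m) p) k ⟩
    ((p ⋆ p ⋆^ m) ⋆ g) k                      ≈⟨ ⋆-congˡ g (Degree≤1⇒⋆≋linMul p₂₊≈0 (p ⋆^ m)) k ⟩
    (linMul (p 0) (p 1) (p ⋆^ m) ⋆ g) k       ≈⟨ linMul-⋆ (p 0) (p 1) _ g k ⟩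
    linMul (p 0) (p 1) (p ⋆^ m ⋆ g) k         ≈⟨ IsLinear.cong (linMul-isLinear (p 0) (p 1))
                                                   (Degree≤1⇒⋆^≋linMul^ p₂₊≈0 m g) k ⟩
    linMul^ (p 0) (p 1) (suc m) g k           ∎

  module _ (lam : Carrier) where

    gen : ℕ → Series R
    gen = genSeries R lam

    eulerA≋∇^ : ∀ n → eulerA R lam n ≋ ∇^ (suc n) (gen n)
    eulerA≋∇^ n = Degree≤1⇒⋆^≋linMul^ {oneMinusX R} (λ _ → refl) (suc n) (gen n)

    eulerA-zero : eulerA R lam 0 ≋ 𝟙
    eulerA-zero zero    = trans (eulerA≋∇^ 0 0) (trans (+-cong (*-identityˡ _) (zeroʳ _)) (+-identityʳ _))
    eulerA-zero (suc k) = trans (eulerA≋∇^ 0 (suc k)) (trans (+-cong (*-identityˡ _) (*-identityʳ _)) (-‿inverseʳ 1#))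

    shift-gen : ∀ n k → shift (gen (suc n)) k ≈ dfall R (ι k) (suc n) lam
    shift-gen n zero    = sym (dfall-0# n lam)
    shift-gen n (suc k) = refl

    -- (k)_{n,λ} = ((k+1) + (-1))_{n,λ} expands by dfall-+, and its top term cancels (k+1)_{n,λ}.
    ∇-gen : ∀ n → ∇ (gen (suc n))
              ≋ sumₛ R (suc n) (λ i → (- 1# * (ι (suc n C i) * dfall R (- 1#) (suc n ∸ i) lam)) · gen i)
    ∇-gen n k = begin
      1# * X + - 1# * shift (gen N) k                   ≈⟨ +-congˡ (*-congˡ (shift-gen n k)) ⟩
      1# * X + - 1# * dfall R (ι k) N lam               ≈⟨ +-congˡ (*-congˡ (dfall-cong N lam (xyx⁻¹≈y 1# (ι k)))) ⟨
      1# * X + - 1# * dfall R (ι (suc k) + - 1#) N lam  ≈⟨ +-congˡ (*-congˡ (dfall-+ (ι (suc k)) (- 1#) lam N)) ⟩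
      1# * X + - 1# * (Σ< N V + V N)                    ≈⟨ +-congˡ (*-congˡ (+-congˡ V-N≈X)) ⟩
      1# * X + - 1# * (Σ< N V + X)                      ≈⟨ solve 4 (λ m x s o → o :* x :+ m :* (s :+ x) := m :* s :+ (o :+ m) :* x)
                                                             refl (- 1#) X (Σ< N V) 1# ⟩
      - 1# * Σ< N V + (1# + - 1#) * X                   ≈⟨ +-congˡ (trans (*-congʳ (-‿inverseʳ 1#)) (zeroˡ X)) ⟩
      - 1# * Σ< N V + 0#                                ≈⟨ +-identityʳ _ ⟩
      - 1# * Σ< N V                                     ≈⟨ *-distribˡ-Σ< N (- 1#) V ⟩
      Σ[ i < N ] - 1# * V i                             ≈⟨ Σ<-cong N (λ i _ →
                                                             solve 4 (λ m C A B → m :* (C :* (A :* B)) := (m :* (C :* B)) :* A)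
                                                               refl (- 1#) (ι (N C i)) (gen i k) (dfall R (- 1#) (N ∸ i) lam)) ⟩
      Σ[ i < N ] coeff i * gen i k                      ≈⟨ sumₛ-apply N _ k ⟨
      sumₛ R N (λ i → coeff i · gen i) k                ∎
      where
      N : ℕ
      N = suc n
      X : Carrier
      X = gen N k
      V coeff : ℕ → Carrier
      V i     = ι (N C i) * (gen i k * dfall R (- 1#) (N ∸ i) lam)
      coeff i = - 1# * (ι (N C i) * dfall R (- 1#) (N ∸ i) lam)

      V-N≈X : V N ≈ X
      V-N≈X = begin
        ι (N C N) * (X * dfall R (- 1#) (N ∸ N) lam)  ≡⟨ ≡.cong₂ (λ a b → ι a * (X * dfall R (- 1#) b lam))
                                                             (nCn≡1 N) (ℕₚ.n∸n≡0 N) ⟩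
        (1# + 0#) * (X * 1#)                           ≈⟨ *-cong (+-identityʳ 1#) (*-identityʳ X) ⟩
        1# * X                                         ≈⟨ *-identityˡ X ⟩
        X                                              ∎

    eulerA⋆xMinusOne^ : ∀ i j → eulerA R lam i ⋆ xMinusOne R ⋆^ j ≋ (- 1#) ^ j · ∇^ (j ℕ.+ suc i) (gen i)
    eulerA⋆xMinusOne^ i j k = begin
      (eulerA R lam i ⋆ xMinusOne R ⋆^ j) k           ≈⟨ ⋆-comm (eulerA R lam i) _ k ⟩
      (xMinusOne R ⋆^ j ⋆ eulerA R lam i) k           ≈⟨ Degree≤1⇒⋆^≋linMul^ {xMinusOne R} (λ _ → refl) j _ k ⟩
      linMul^ (- 1#) 1# j (eulerA R lam i) k          ≈⟨ linMul^[-1,1]≋±∇^ j _ k ⟩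
      (- 1#) ^ j * ∇^ j (eulerA R lam i) k            ≈⟨ *-congˡ (IsLinear.cong (linMul^-isLinear 1# (- 1#) j)
                                                                                (eulerA≋∇^ i) k) ⟩
      (- 1#) ^ j * ∇^ j (∇^ (suc i) (gen i)) k        ≡⟨ ≡.cong (λ f → (- 1#) ^ j * f k) (fold-+ (gen i) ∇ j) ⟨
      (- 1#) ^ j * ∇^ (j ℕ.+ suc i) (gen i) k         ∎

    recRHS-term : ∀ {n i} m j → m ≡.≡ suc j → j ℕ.+ suc i ≡.≡ n →
      ∇^ n ((- 1# * (ι (n C i) * dfall R (- 1#) m lam)) · gen i)
        ≋ (ι (n C i) * dfall R 1# m (- lam)) · (eulerA R lam i ⋆ xMinusOne R ⋆^ (m ∸ 1))
    recRHS-term {i = i} _ j ≡.refl ≡.refl k = begin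
      ∇^ n ((- 1# * (b * dfall R (- 1#) (suc j) lam)) · gen i) k
        ≈⟨ IsLinear.·-homo (linMul^-isLinear 1# (- 1#) n) _ (gen i) k ⟩
      (- 1# * (b * dfall R (- 1#) (suc j) lam)) * Y
        ≈⟨ solve 4 (λ m C D Y → (m :* (C :* D)) :* Y := C :* (m :* D) :* Y) refl (- 1#) b (dfall R (- 1#) (suc j) lam) Y ⟩
      b * (- 1# * dfall R (- 1#) (suc j) lam) * Y
        ≈⟨ *-congʳ (*-congˡ (-1*dfall[-1]≈dfall[1]*±1 j lam)) ⟩
      b * (d * (- 1#) ^ j) * Y
        ≈⟨ solve 4 (λ C d s Y → C :* (d :* s) :* Y := (C :* d) :* (s :* Y)) refl b d ((- 1#) ^ j) Y ⟩
      (b * d) * ((- 1#) ^ j * Y)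
        ≈⟨ *-congˡ (eulerA⋆xMinusOne^ i j k) ⟨
      (b * d) * (eulerA R lam i ⋆ xMinusOne R ⋆^ j) k
        ∎
      where
      n : ℕ
      n = j ℕ.+ suc i
      b d Y : Carrier
      b = ι (n C i)
      d = dfall R 1# (suc j) (- lam)
      Y = ∇^ n (gen i) k

    eulerA-suc : ∀ n → eulerA R lam (suc n) ≋ recRHS R lam (suc n)
    eulerA-suc n k = begin
      eulerA R lam N k                                ≈⟨ eulerA≋∇^ N k ⟩
      ∇^ (suc N) (gen N) k                            ≡⟨ ≡.cong (λ m → ∇^ m (gen N) k) (ℕₚ.+-comm 1 N) ⟩
      ∇^ (N ℕ.+ 1) (gen N) k                          ≡⟨ ≡.cong (λ f → f k) (fold-+ (gen N) ∇ N) ⟩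
      ∇^ N (∇ (gen N)) k                              ≈⟨ IsLinear.cong ∇^N (∇-gen n) k ⟩
      ∇^ N (sumₛ R N (λ i → coeff i · gen i)) k       ≈⟨ IsLinear⇒sumₛ-homo ∇^N N _ k ⟩
      sumₛ R N (λ i → ∇^ N (coeff i · gen i)) k       ≈⟨ sumₛ-cong N (λ i i<N → term (ℕ.s≤s⁻¹ i<N)) k ⟩
      recRHS R lam N k                                ∎
      where
      N : ℕ
      N = suc n
      coeff : ℕ → Carrier
      coeff i = - 1# * (ι (N C i) * dfall R (- 1#) (N ∸ i) lam)
      ∇^N : IsLinear (∇^ N)
      ∇^N = linMul^-isLinear 1# (- 1#) N
      term : ∀ {i} → i ≤ n → ∇^ N (coeff i · gen i)
             ≋ (ι (N C i) * dfall R 1# (N ∸ i) (- lam)) · (eulerA R lam i ⋆ xMinusOne R ⋆^ (N ∸ i ∸ 1))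
      term {i} i≤n = recRHS-term (N ∸ i) (n ∸ i) (ℕₚ.+-∸-assoc 1 i≤n)
                       (≡.trans (ℕₚ.+-suc (n ∸ i) i) (≡.cong suc (ℕₚ.m∸n+n≡m i≤n)))

theorem2p3 : {c ℓ : Level} (R : CommutativeRing c ℓ) (lam : CommutativeRing.Carrier R) →
    ¬ (CommutativeRing._≈_ R lam (CommutativeRing.0# R)) →
    _≈ₛ_ R (eulerA R lam 0) (oneₛ R) ×
    ((n : ℕ) → 1 ≤ n → _≈ₛ_ R (eulerA R lam n) (recRHS R lam n))
-- The identity holds for every λ.
theorem2p3 R lam _ = eulerA-zero R lam , λ { zero () ; (suc n) _ → eulerA-suc R lam n }
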